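{- Let $A$ be a nontrivial closed class of decision tables from $\mathcal{M}_2^{\infty}$, let $\psi$ be a bounded complexity measure, $n\in\omega$, $T\in A_\psi(n)$, and $G(T)>0$. Then there exists a decision table $T^*\in[T]$ such that $\psi^a(T^*)\le n$ and $\psi^d(T^*)\ge G(T)-1$.
   Context: Let $\omega=\{0,1,2,\ldots\}$, let $\mathcal{P}(\omega)$ be the set of nonempty finite subsets of $\omega$, and $E_2=\{0,1\}$. Let $P=\{f_i:i\in\omega\}$ be a set of attributes ($f_i\neq f_j$ iff $i\neq j$). $\mathcal{M}_2^{\infty}$ is the set of rectangular tables filled with numbers from $E_2$ whose rows are pairwise different, each row labeled with a set from $\mathcal{P}(\omega)$ (its set of decisions), and whose columns are labeled with pairwise different attributes from $P$; tables with no rows, all denoted $\Lambda$, also belong to $\mathcal{M}_2^{\infty}$. For $T\in\mathcal{M}_2^\infty$: $\Delta(T)$ is its set of rows, $\operatorname{At}(T)$ its set of column attributes, $\Pi(T)$ the intersection of the decision sets of all rows. For nonempty $T$, $\Omega_2(T)$ is the set of finite words (including the empty word $\lambda$) over the alphabet $\{(f_i,\delta):f_i\in\operatorname{At}(T),\delta\in E_2\}$; for $\alpha=(f_{i_1},\delta_1)\cdots(f_{i_m},\delta_m)$, $T\alpha$ is the subtable of rows having $\delta_1,\ldots,\delta_m$ in the columns labeled $f_{i_1},\ldots,f_{i_m}$ respectively ($T\lambda=T$). Operations: for $D\subseteq\operatorname{At}(T)$, $I(D,T)$ is obtained by deleting the columns labeled by attributes in $D$ and, in each group of rows equal on the remaining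 columns, keeping only the first one; for $\nu:E_2^{|\operatorname{At}(T)|}\to\mathcal{P}(\omega)$, $J(\nu,T)$ replaces the decision set of each row $\bar\delta$ by $\nu(\bar\delta)$. $[T]=\{J(\nu,I(D,T)):D\subseteq\operatorname{At}(T),\nu:E_2^{|\operatorname{At}(T)\setminus D|}\to\mathcal{P}(\omega)\}$, $[A]=\bigcup_{T\in A}[T]$; $A$ is a closed class if $[A]=A$, nontrivial if it contains a nonempty table. Decision trees: a $2$-decision tree is a finite directed rooted tree with at least two nodes, where the root and edges leaving it are unlabeled, terminal nodes are labeled with decisions from $\omega$, and every other node is labeled with an attribute from $P$, each edge leaving it labeled with a number from $E_2$. $\operatorname{At}(\Gamma)$ is the set of attributes labeling its nodes. For a complete path $\tau=v_1,d_1,\ldots,v_m,d_m,v_{m+1}$ (root to a terminal node), $\pi(\tau)=\lambda$ if $m=1$, otherwise $\pi(\tau)=(f_{i_2},\delta_2)\cdots(f_{i_m},\delta_m)$ where $v_j$ is labeled $f_{i_j}$ and $d_j$ is labeled $\delta_j$; $T(\tau)=T\pi(\tau)$. For nonempty $T$, a nondeterministic decision tree for $T$ is a $2$-decision tree $\Gamma$ with $\operatorname{At}(\Gamma)\subseteq\operatorname{At}(T)$ such that each row of $T$ belongs to $T(\tau)$ for some complete path $\tau$, and for each complete path $\tau$ either $T(\tau)=\Lambda$ or the decision at its terminal node lies in $\Pi(T(\tau))$. A deterministic decision tree for $T$ is a nondeterministic one in which exactly one edge leaves the root and edges leaving any other nonterminal node have pairwise different labels. Complexity measures: $P^*$ is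 the set of finite words over $P$ (including $\lambda$). A partially bounded complexity measure is $\psi:P^*\to\omega$ with: $\psi(\alpha)=0$ iff $\alpha=\lambda$; $\psi$ invariant under permutation of letters; $\psi(\alpha_1)\le\psi(\alpha_1\alpha_2)$; $\psi(\alpha_1\alpha_2)\le\psi(\alpha_1)+\psi(\alpha_2)$. It is bounded if also $\psi(\alpha)\ge|\alpha|$ for all $\alpha$. Extend $\psi$ to words over pairs by $\psi((f_{i_1},\delta_1)\cdots(f_{i_m},\delta_m))=\psi(f_{i_1}\cdots f_{i_m})$, $\psi(\lambda)=0$, and to trees by $\psi(\Gamma)=\max_\tau\psi(\pi(\tau))$ over complete paths. For nonempty $T$, $\psi^d(T)$ ($\psi^a(T)$) is the minimum of $\psi(\Gamma)$ over deterministic (nondeterministic) decision trees for $T$; $\psi^d(\Lambda)=\psi^a(\Lambda)=0$. A word $\alpha\in\Omega_2(T)$ is annihilating for $T$ if $T\alpha=\Lambda$ and $\alpha$ contains no two letters $(f_i,\delta),(f_i,\sigma)$ with $\delta\neq\sigma$; it is irreducible if no word obtained from $\alpha$ by deleting some letters and different from $\alpha$ is annihilating. $G(T)$ is the maximum length of an irreducible annihilating word for $T$, or $0$ if none exists; $G(\Lambda)=0$. $m_\psi(T)=\max\{\psi(f_i):f_i\in\operatorname{At}(T)\}$, $m_\psi(\Lambda)=0$; $A_\psi(n)=\{T\in A:m_\psi(T)\le n\}$. -}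

module Defs where

open import Data.Nat using (ℕ; zero; suc; _≤_; _<_; _⊔_; _+_; _∸_)
import Data.Nat as N
open import Data.Bool using (Bool; true; false)
import Data.Bool as B
open import Data.Maybe using (Maybe; just; nothing)
import Data.Maybe.Properties as MP
open import Data.List using (List; []; _∷_; map; filter; length; deduplicate; _++_; concatMap; foldr)
import Data.List.Properties as LP
open import Data.List.NonEmpty using (List⁺; toList)
open import Data.List.Membership.Propositional using (_∈_)
open import Data.List.Membership.DecPropositional N._≟_ using (_∈?_)
open import Data.List.Relation.Unary.All using (All; all?)
open import Data.List.Relation.Unary.Unique.Propositional using (Unique)
open import Data.List.Relation.Binary.Permutation.Propositional using (_↭_)
import Data.List.Relation.Binary.Sublist.Propositional as SL
open import Data.Product using (Σ; ∃; _×_; _,_; proj₁; proj₂)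
open import Data.Sum using (_⊎_)
open import Data.Unit using (⊤)
open import Data.Empty using (⊥)
open import Relation.Nullary using (¬_; Dec; yes; no; ¬?)
open import Relation.Binary.PropositionalEquality using (_≡_; _≢_)
open import Function using (_∘_; _⇔_)

-- Attribute f_i is represented by the index i : ℕ.
-- A row is the list of its values (aligned with the column list `cols`)
-- together with its decision set (a nonempty finite subset of ω, given
-- as a nonempty list; only membership is ever used).

DecSet : Set
DecSet = List⁺ ℕ

Row : Set
Row = List Bool × DecSet

record Table : Set where
  constructor mkTable
  field
    cols : List ℕ
    rows : List Row
open Table public

InM : Table → Set
InM T = Unique (cols T)
      × All (λ r → length (proj₁ r) ≡ length (cols T)) (rows T)
      × Unique (map proj₁ (rows T))

IsΛ : Table → Set
IsΛ T = rows T ≡ []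

val : List ℕ → List Bool → ℕ → Maybe Bool
val [] _ f = nothing
val (c ∷ cs) [] f = nothing
val (c ∷ cs) (b ∷ bs) f with c N.≟ f
... | yes _ = just b
... | no  _ = val cs bs f

restrict : List ℕ → List ℕ → List Bool → List Bool
restrict D [] bs = []
restrict D (c ∷ cs) [] = []
restrict D (c ∷ cs) (b ∷ bs) with c ∈? D
... | yes _ = restrict D cs bs
... | no  _ = b ∷ restrict D cs bs

I : List ℕ → Table → Table
I D T = mkTable (filter (λ c → ¬? (c ∈? D)) (cols T))
                (deduplicate (λ r s → LP.≡-dec B._≟_ (proj₁ r) (proj₁ s))
                   (map (λ r → restrict D (cols T) (proj₁ r) , proj₂ r) (rows T)))

J : (List Bool → DecSet) → Table → Table
J ν T = mkTable (cols T) (map (λ r → proj₁ r , ν (proj₁ r)) (rows T))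

_∈[_] : Table → Table → Set
T' ∈[ T ] = Σ (List ℕ) λ D → Σ (List Bool → DecSet) λ ν →
              All (_∈ cols T) D × T' ≡ J ν (I D T)

Class : Set₁
Class = Table → Set

ClassOfM : Class → Set
ClassOfM A = ∀ T → A T → InM T

Closed : Class → Set
Closed A = ∀ T' → (Σ Table λ T → A T × T' ∈[ T ]) ⇔ A T'

Nontrivial : Class → Set
Nontrivial A = Σ Table λ T → A T × ¬ IsΛ T

Letter : Set
Letter = ℕ × Bool

Word : Set
Word = List Letter

sat : List ℕ → List Bool → Letter → Set
sat cs bs (f , δ) = val cs bs f ≡ just δ

sat? : (cs : List ℕ) (bs : List Bool) (l : Letter) → Dec (sat cs bs l)
sat? cs bs (f , δ) = MP.≡-dec B._≟_ (val cs bs f) (just δ)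

InΩ : Table → Word → Set
InΩ T α = All (λ l → proj₁ l ∈ cols T) α

sub : Table → Word → Table
sub T α = mkTable (cols T) (filter (λ r → all? (sat? (cols T) (proj₁ r)) α) (rows T))

InΠ : ℕ → Table → Set
InΠ d T = All (λ r → d ∈ toList (proj₂ r)) (rows T)

-- A tree is given by the list of subtrees hanging from
-- the (unlabelled) root: at least one.  A nonterminal non-root node is
-- labelled by an attribute and has at least one outgoing edge, each edge
-- labelled by a Boolean; terminal nodes carry a decision.

data Node : Set where
  leaf : ℕ → Node
  node : ℕ → (Bool × Node) → List (Bool × Node) → Node

record Tree : Set where
  constructor tree
  field
    first : Node
    others : List Node
open Tree public

mutual
  pathsN : Node → List (Word × ℕ)
  pathsN (leaf d) = (([] , d) ∷ [])
  pathsN (node f c cs) = pathsE f c ++ pathsEs f cs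

  pathsE : ℕ → Bool × Node → List (Word × ℕ)
  pathsE f (δ , n) = map (λ p → ((f , δ) ∷ proj₁ p) , proj₂ p) (pathsN n)

  pathsEs : ℕ → List (Bool × Node) → List (Word × ℕ)
  pathsEs f [] = []
  pathsEs f (c ∷ cs) = pathsE f c ++ pathsEs f cs

pathsNs : List Node → List (Word × ℕ)
pathsNs [] = []
pathsNs (n ∷ ns) = pathsN n ++ pathsNs ns

paths : Tree → List (Word × ℕ)
paths Γ = pathsN (first Γ) ++ pathsNs (others Γ)

mutual
  attN : Node → List ℕ
  attN (leaf d) = []
  attN (node f (_ , n) cs) = f ∷ attN n ++ attEs cs

  attEs : List (Bool × Node) → List ℕ
  attEs [] = []
  attEs ((_ , n) ∷ cs) = attN n ++ attEs cs

attNs : List Node → List ℕ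
attNs [] = []
attNs (n ∷ ns) = attN n ++ attNs ns

At : Tree → List ℕ
At Γ = attN (first Γ) ++ attNs (others Γ)

mutual
  DetN : Node → Set
  DetN (leaf d) = ⊤
  DetN (node f (δ , n) cs) = Unique (δ ∷ map proj₁ cs) × DetN n × DetEs cs

  DetEs : List (Bool × Node) → Set
  DetEs [] = ⊤
  DetEs ((_ , n) ∷ cs) = DetN n × DetEs cs

NDTreeFor : Table → Tree → Set
NDTreeFor T Γ =
    All (_∈ cols T) (At Γ)
  × (∀ r → r ∈ rows T → Σ (Word × ℕ) λ τ → τ ∈ paths Γ × r ∈ rows (sub T (proj₁ τ)))
  × (∀ τ → τ ∈ paths Γ → IsΛ (sub T (proj₁ τ)) ⊎ InΠ (proj₂ τ) (sub T (proj₁ τ)))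

-- deterministic decision tree for (nonempty) T: exactly one edge leaves
-- the root, and the determinism condition at all other nodes
DTreeFor : Table → Tree → Set
DTreeFor T Γ = NDTreeFor T Γ × others Γ ≡ [] × DetN (first Γ)

IsPBComplexityMeasure : (List ℕ → ℕ) → Set
IsPBComplexityMeasure ψ =
    (∀ α → ψ α ≡ 0 ⇔ α ≡ [])
  × (∀ α β → α ↭ β → ψ α ≡ ψ β)
  × (∀ α β → ψ α ≤ ψ (α ++ β))
  × (∀ α β → ψ (α ++ β) ≤ ψ α + ψ β)

IsBoundedComplexityMeasure : (List ℕ → ℕ) → Set
IsBoundedComplexityMeasure ψ =
  IsPBComplexityMeasure ψ × (∀ α → length α ≤ ψ α)

ψw : (List ℕ → ℕ) → Word → ℕ
ψw ψ α = ψ (map proj₁ α)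

ψt : (List ℕ → ℕ) → Tree → ℕ
ψt ψ Γ = foldr _⊔_ 0 (map (ψw ψ ∘ proj₁) (paths Γ))

-- ψ^a(T) ≤ k   (ψ^a(Λ) = 0; otherwise min over nondeterministic trees)
ψᵃ≤ : (List ℕ → ℕ) → Table → ℕ → Set
ψᵃ≤ ψ T k = IsΛ T ⊎ (Σ Tree λ Γ → NDTreeFor T Γ × ψt ψ Γ ≤ k)

-- ψ^d(T) ≥ k   (ψ^d(Λ) = 0; otherwise min over deterministic trees)
ψᵈ≥ : (List ℕ → ℕ) → Table → ℕ → Set
ψᵈ≥ ψ T k = (IsΛ T → k ≤ 0) × (¬ IsΛ T → ∀ Γ → DTreeFor T Γ → k ≤ ψt ψ Γ)

Consistent : Word → Set
Consistent α = ∀ f δ σ → (f , δ) ∈ α → (f , σ) ∈ α → δ ≡ σ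

Annihilating : Table → Word → Set
Annihilating T α = InΩ T α × IsΛ (sub T α) × Consistent α

Irreducible : Table → Word → Set
Irreducible T α = ∀ β → β SL.⊆ α → β ≢ α → ¬ Annihilating T β

IrrAnn : Table → Word → Set
IrrAnn T α = Annihilating T α × Irreducible T α

-- G(T) ≡ g  (maximum length of an irreducible annihilating word, 0 if none;
-- for T = Λ the only irreducible annihilating word is λ, so g = 0)
IsG : Table → ℕ → Set
IsG T g = (∀ α → IrrAnn T α → length α ≤ g)
        × ((Σ Word λ α → IrrAnn T α × length α ≡ g)
           ⊎ ((∀ α → ¬ IrrAnn T α) × g ≡ 0))

-- m_ψ(T) ≤ n  ;  T ∈ A_ψ(n)  iff  A T × m_ψ(T) ≤ n
mψ≤ : (List ℕ → ℕ) → Table → ℕ → Set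
mψ≤ ψ T n = All (λ f → ψ (f ∷ []) ≤ n) (cols T)

{-# OPTIONS --safe #-}
-- Let α be an irreducible annihilating word of T. Irreducibility gives, for every letter of α,
-- a row of T satisfying all the other letters of α and (as α annihilates T) violating this one.
-- Delete the columns not occurring in α and label every row by the attributes of the letters of α
-- it violates; call the result T*. Guessing a violated letter and checking it is a
-- nondeterministic tree whose paths query a single attribute each, so ψᵃ(T*) ≤ n. In a
-- deterministic tree for T*, the witness rows of all letters whose attribute is not the one
-- queried at a node agree there and take a common edge, so at most one witness leaves the path
-- at each node: some path has length at least |α| − 1, and ψ dominates length.
module Submission where

open import Defs
open import Data.Nat using (ℕ; suc; _≤_; _<_; _∸_; _⊔_; z≤n; s≤s)
import Data.Nat as N
import Data.Nat.Properties as NP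
open import Data.Bool using (Bool; not)
import Data.Bool as B
import Data.Bool.Properties as BP
open import Data.Maybe using (just; nothing)
import Data.Maybe.Properties as MP
open import Data.List using (List; []; _∷_; map; filter; length)
import Data.List.Properties as LP
open import Data.List.Relation.Unary.Any as Any using (here; there; _─_)
import Data.List.Relation.Unary.Any.Properties as AnyP
open import Data.List.Relation.Unary.All as All using (All; []; _∷_)
import Data.List.Relation.Unary.All.Properties as AllP
open import Data.List.Relation.Unary.AllPairs using ([]; _∷_)
import Data.List.Relation.Unary.AllPairs.Properties as AllPairsP
open import Data.List.Relation.Unary.Unique.Propositional using (Unique)
import Data.List.Relation.Binary.Sublist.Propositional as SL
import Data.List.Relation.Binary.Sublist.Propositional.Properties as SLP
open import Data.List.Membership.Propositional using (_∈_; _∉_; find; mapWith∈)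
open import Data.List.Membership.DecPropositional N._≟_ using (_∈?_)
open import Data.List.Membership.Propositional.Properties
  using (∈-++⁻; ∈-++⁺ˡ; ∈-++⁺ʳ; ∈-map⁺; ∈-map⁻; ∈-filter⁺; ∈-filter⁻; ∈-deduplicate⁻;
         map-mapWith∈; mapWith∈≗map)
open import Data.List.Membership.Setoid.Properties using (length-mapWith∈)
open import Data.List.NonEmpty using (toList) renaming (_∷_ to _∷⁺_)
open import Data.Product using (Σ; _×_; _,_; proj₁; proj₂)
open import Data.Sum using (_⊎_; inj₁; inj₂)
open import Data.Empty using (⊥-elim)
open import Relation.Nullary using (¬_; ¬?; Dec; yes; no)
open import Function using (_∘_)
import Relation.Binary.PropositionalEquality as ≡
open import Relation.Binary.PropositionalEquality using (_≡_; _≢_; refl; sym; trans; cong; subst)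

unique-map-injective : ∀ {A B : Set} {g : A → B} {xs x y} → Unique (map g xs) →
  x ∈ xs → y ∈ xs → g x ≡ g y → x ≡ y
unique-map-injective u (here refl) (here refl) _ = refl
unique-map-injective (g∉ ∷ _) (here refl) (there y∈) eq = ⊥-elim (All.lookup g∉ (∈-map⁺ _ y∈) eq)
unique-map-injective (g∉ ∷ _) (there x∈) (here refl) eq = ⊥-elim (All.lookup g∉ (∈-map⁺ _ x∈) (sym eq))
unique-map-injective (_ ∷ u) (there x∈) (there y∈) eq = unique-map-injective u x∈ y∈ eq

module _ {A : Set} where

  ─-⊆ : ∀ {x : A} {xs} (p : x ∈ xs) → (xs ─ p) SL.⊆ xs
  ─-⊆ {xs = x ∷ xs} (here refl) = x SL.∷ʳ SL.⊆-refl
  ─-⊆ {xs = x ∷ xs} (there p) = refl SL.∷ ─-⊆ p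

  ─-≢ : ∀ {x : A} {xs} (p : x ∈ xs) → (xs ─ p) ≢ xs
  ─-≢ {xs = xs} p eq = NP.<-irrefl (cong length eq)
    (NP.≤-reflexive (sym (LP.length-removeAt′ xs (Any.index p))))

  ∈-─⁺ : ∀ {x y : A} {xs} → y ∈ xs → y ≢ x → (p : x ∈ xs) → y ∈ (xs ─ p)
  ∈-─⁺ (here refl) y≢x (here refl) = ⊥-elim (y≢x refl)
  ∈-─⁺ (there y∈) _ (here refl) = y∈
  ∈-─⁺ (here y≡) _ (there p) = here y≡
  ∈-─⁺ (there y∈) y≢x (there p) = there (∈-─⁺ y∈ y≢x p)

  ∉-─⇒unique : ∀ {xs : List A} → (∀ {x} (p : x ∈ xs) → x ∉ (xs ─ p)) → Unique xs
  ∉-─⇒unique {[]} _ = []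
  ∉-─⇒unique {x ∷ xs} ∉─ =
    All.tabulate (λ y∈ x≡y → ∉─ (here refl) (subst (_∈ xs) (sym x≡y) y∈))
    ∷ ∉-─⇒unique (λ p y∈ → ∉─ (there p) (there y∈))

unique-attributes : ∀ α → Consistent α → Unique α → Unique (map proj₁ α)
unique-attributes [] _ _ = []
unique-attributes ((f , δ) ∷ α) cons (x∉ ∷ u) =
  AllP.map⁺ (All.tabulate same-attribute)
  ∷ unique-attributes α (λ f δ σ p q → cons f δ σ (there p) (there q)) u
  where
  same-attribute : ∀ {y} → y ∈ α → f ≢ proj₁ y
  same-attribute {_ , σ} y∈ refl = All.lookup x∉ y∈ (cong (f ,_) (cons f δ σ (here refl) (there y∈)))

annihilating-⊆ : ∀ {T α β} → β SL.⊆ α → Annihilating T α → IsΛ (sub T β) → Annihilating T β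
annihilating-⊆ β⊆α (inΩ , _ , cons) empty =
  SLP.All-resp-⊆ β⊆α inΩ , empty , λ f δ σ p q → cons f δ σ (SL.lookup β⊆α p) (SL.lookup β⊆α q)

-- The value at [] is junk: toDecSet is only applied to nonempty lists.
toDecSet : List ℕ → DecSet
toDecSet [] = 0 ∷⁺ []
toDecSet (d ∷ ds) = d ∷⁺ ds

∈-toDecSet⁺ : ∀ {d ds} → d ∈ ds → d ∈ toList (toDecSet ds)
∈-toDecSet⁺ {ds = _ ∷ _} d∈ = d∈

∈-toDecSet⁻ : ∀ {d d′ ds} → d′ ∈ ds → d ∈ toList (toDecSet ds) → d ∈ ds
∈-toDecSet⁻ {ds = _ ∷ _} _ d∈ = d∈

val-[] : ∀ cs {f} → val cs [] f ≡ nothing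
val-[] [] = refl
val-[] (c ∷ cs) = refl

val-restrict : ∀ D cs bs {f} → f ∉ D →
  val (filter (λ c → ¬? (c ∈? D)) cs) (restrict D cs bs) f ≡ val cs bs f
val-restrict D [] bs f∉D = refl
val-restrict D (c ∷ cs) [] f∉D = val-[] (filter (λ c → ¬? (c ∈? D)) (c ∷ cs))
val-restrict D (c ∷ cs) (b ∷ bs) {f} f∉D with c ∈? D
... | yes c∈D with c N.≟ f
...   | yes refl = ⊥-elim (f∉D c∈D)
...   | no _ = val-restrict D cs bs f∉D
val-restrict D (c ∷ cs) (b ∷ bs) {f} f∉D | no _ with c N.≟ f
...   | yes _ = refl
...   | no _ = val-restrict D cs bs f∉D

val-just⇒∈ : ∀ cs bs {f b} → val cs bs f ≡ just b → f ∈ cs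
val-just⇒∈ (c ∷ cs) (b ∷ bs) {f} eq with c N.≟ f
... | yes refl = here refl
... | no _ = there (val-just⇒∈ cs bs eq)

val-total : ∀ cs bs {f} → f ∈ cs → length bs ≡ length cs → Σ Bool λ b → val cs bs f ≡ just b
val-total (c ∷ cs) (b ∷ bs) {f} f∈ len with c N.≟ f | f∈
... | yes _ | _ = b , refl
... | no c≢f | here f≡c = ⊥-elim (c≢f (sym f≡c))
... | no _ | there f∈cs = val-total cs bs f∈cs (NP.suc-injective len)

¬sat⇒sat-not : ∀ {cs bs f δ} → f ∈ cs → length bs ≡ length cs →
  ¬ sat cs bs (f , δ) → sat cs bs (f , not δ)
¬sat⇒sat-not {cs} {bs} f∈ len ¬s with val-total cs bs f∈ len
... | b , vb = trans vb (cong just (BP.¬-not (λ b≡δ → ¬s (trans vb (cong just b≡δ)))))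

sat-not⇒¬sat : ∀ {cs bs f δ} → sat cs bs (f , not δ) → ¬ sat cs bs (f , δ)
sat-not⇒¬sat s s′ = BP.not-¬ refl (MP.just-injective (trans (sym s′) s))

∈-sub⁻ : ∀ T w {r} → r ∈ rows (sub T w) → r ∈ rows T × All (sat (cols T) (proj₁ r)) w
∈-sub⁻ T w = ∈-filter⁻ (λ r → All.all? (sat? (cols T) (proj₁ r)) w)

∈-sub⁺ : ∀ T w {r} → r ∈ rows T → All (sat (cols T) (proj₁ r)) w → r ∈ rows (sub T w)
∈-sub⁺ T w = ∈-filter⁺ (λ r → All.all? (sat? (cols T) (proj₁ r)) w)

∈⇒¬IsΛ : ∀ T {r} → r ∈ rows T → ¬ IsΛ T
∈⇒¬IsΛ (mkTable _ []) ()
∈⇒¬IsΛ (mkTable _ (_ ∷ _)) _ ()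

IsΛ-sub⇒¬All : ∀ T w {r} → IsΛ (sub T w) → r ∈ rows T → ¬ All (sat (cols T) (proj₁ r)) w
IsΛ-sub⇒¬All T w empty r∈ sats = ∈⇒¬IsΛ (sub T w) (∈-sub⁺ T w r∈ sats) empty

¬IsΛ⇒∈ : ∀ T → ¬ IsΛ T → Σ Row (_∈ rows T)
¬IsΛ⇒∈ (mkTable _ []) ne = ⊥-elim (ne refl)
¬IsΛ⇒∈ (mkTable _ (r ∷ _)) _ = r , here refl

decision-J : ∀ ν T {r} → r ∈ rows (J ν T) → proj₂ r ≡ ν (proj₁ r)
decision-J ν T r∈ with ∈-map⁻ (λ r → proj₁ r , ν (proj₁ r)) r∈
... | _ , _ , refl = refl

module _ (D : List ℕ) (ν : List Bool → DecSet) (T : Table) where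

  private
    restrictRow : Row → Row
    restrictRow r = restrict D (cols T) (proj₁ r) , proj₂ r
    sameValues? = λ (r s : Row) → LP.≡-dec B._≟_ (proj₁ r) (proj₁ s)

  ∈-JI⁺ : ∀ {r} → r ∈ rows T →
    (restrict D (cols T) (proj₁ r) , ν (restrict D (cols T) (proj₁ r))) ∈ rows (J ν (I D T))
  ∈-JI⁺ r∈ with find (AnyP.deduplicate⁺ sameValues? (λ yx vx → trans vx (sym yx))
                        (Any.map (cong proj₁) (∈-map⁺ restrictRow r∈)))
  ... | (_ , _) , s∈ , refl = ∈-map⁺ (λ r → proj₁ r , ν (proj₁ r)) s∈

  ∈-JI⁻ : ∀ {r} → r ∈ rows (J ν (I D T)) →
    Σ Row λ r₀ → r₀ ∈ rows T × proj₁ r ≡ restrict D (cols T) (proj₁ r₀)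
  ∈-JI⁻ r∈ with ∈-map⁻ (λ r → proj₁ r , ν (proj₁ r)) r∈
  ... | s , s∈ , refl
    with ∈-map⁻ restrictRow (∈-deduplicate⁻ sameValues? (map restrictRow (rows T)) s∈)
  ...   | r₀ , r₀∈ , refl = r₀ , r₀∈ , refl

extendPath : ℕ → Bool → Word × ℕ → Word × ℕ
extendPath f δ q = (f , δ) ∷ proj₁ q , proj₂ q

∈-pathsEs⁻ : ∀ {f es τ} → τ ∈ pathsEs f es →
  Σ (Bool × Node) λ e → e ∈ es ×
    Σ (Word × ℕ) λ q → q ∈ pathsN (proj₂ e) × τ ≡ extendPath f (proj₁ e) q
∈-pathsEs⁻ {f} {(δ , n) ∷ es} τ∈ with ∈-++⁻ (pathsE f (δ , n)) τ∈
... | inj₁ τ∈ₕ = (δ , n) , here refl , ∈-map⁻ (extendPath f δ) τ∈ₕ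
... | inj₂ τ∈ₜ = let e , e∈ , rest = ∈-pathsEs⁻ τ∈ₜ in e , there e∈ , rest

∈-pathsEs⁺ : ∀ {f es e q} → e ∈ es → q ∈ pathsN (proj₂ e) →
  extendPath f (proj₁ e) q ∈ pathsEs f es
∈-pathsEs⁺ {f} {(δ , n) ∷ es} (here refl) q∈ = ∈-++⁺ˡ (∈-map⁺ (extendPath f δ) q∈)
∈-pathsEs⁺ {f} {e ∷ es} (there e∈) q∈ = ∈-++⁺ʳ (pathsE f e) (∈-pathsEs⁺ e∈ q∈)

DetEs⇒All : ∀ es → DetEs es → All (λ e → DetN (proj₂ e)) es
DetEs⇒All [] _ = []
DetEs⇒All (_ ∷ es) (det , dets) = det ∷ DetEs⇒All es dets

module _ (ψ : List ℕ → ℕ) (Γ : Tree) where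

  ψw≤ψt : ∀ {τ} → τ ∈ paths Γ → ψw ψ (proj₁ τ) ≤ ψt ψ Γ
  ψw≤ψt τ∈ = All.lookup (LP.foldr-forcesᵇ {P = _≤ ψt ψ Γ} {f = _⊔_}
                          (λ m n m⊔n≤ → NP.m⊔n≤o⇒m≤o m n m⊔n≤ , NP.m⊔n≤o⇒n≤o m n m⊔n≤)
                          0 _ NP.≤-refl)
                (∈-map⁺ (ψw ψ ∘ proj₁) τ∈)

  ψt≤ : ∀ {n} → (∀ {τ} → τ ∈ paths Γ → ψw ψ (proj₁ τ) ≤ n) → ψt ψ Γ ≤ n
  ψt≤ {n} bound =
    LP.foldr-preservesᵇ {P = _≤ n} {f = _⊔_} NP.⊔-lub z≤n (AllP.map⁺ (All.tabulate bound))

refuteNode : Letter → Node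
refuteNode (f , δ) = node f (not δ , leaf f) []

refutation : Letter → Word × ℕ
refutation (f , δ) = (f , not δ) ∷ [] , f

pathsNs-refuteNode : ∀ ys → pathsNs (map refuteNode ys) ≡ map refutation ys
pathsNs-refuteNode [] = refl
pathsNs-refuteNode ((f , δ) ∷ ys) = cong (refutation (f , δ) ∷_) (pathsNs-refuteNode ys)

attNs-refuteNode : ∀ ys → attNs (map refuteNode ys) ≡ map proj₁ ys
attNs-refuteNode [] = refl
attNs-refuteNode ((f , δ) ∷ ys) = cong (f ∷_) (attNs-refuteNode ys)

module LongPath {K : Set} (cs : List ℕ) (tag : K → ℕ) (row : K → List Bool)
  (agree : ∀ k k′ {f δ δ′} → f ≢ tag k → f ≢ tag k′ →
           sat cs (row k) (f , δ) → sat cs (row k′) (f , δ′) → δ ≡ δ′) where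

  RoutedBy : List (Word × ℕ) → K → Set
  RoutedBy ps k = Σ (Word × ℕ) λ τ → τ ∈ ps × All (sat cs (row k)) (proj₁ τ) × proj₂ τ ≡ tag k

  tag≢? : ∀ f k → Dec (tag k ≢ f)
  tag≢? f k = ¬? (tag k N.≟ f)

  at-most-one-tagged : ∀ f F → Unique (map tag F) → length F ≤ suc (length (filter (tag≢? f) F))
  at-most-one-tagged f [] _ = z≤n
  at-most-one-tagged f (k ∷ F) (tag∉ ∷ u) with tag k N.≟ f
  ... | no tag≢f rewrite LP.filter-accept (tag≢? f) {k} {F} tag≢f = s≤s (at-most-one-tagged f F u)
  ... | yes refl = NP.≤-reflexive (cong (suc ∘ length) (sym (begin
    filter (tag≢? f) (k ∷ F) ≡⟨ LP.filter-reject (tag≢? f) {k} {F} (λ ne → ne refl) ⟩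
    filter (tag≢? f) F       ≡⟨ LP.filter-all (tag≢? f) (All.map (_∘ sym) (AllP.map⁻ tag∉)) ⟩
    F                        ∎)))
    where open ≡.≡-Reasoning

  filter-tags-unique : ∀ f {F} → Unique (map tag F) → Unique (map tag (filter (tag≢? f) F))
  filter-tags-unique f uF = AllPairsP.map⁺ (AllPairsP.filter⁺ (tag≢? f) (AllPairsP.map⁻ uF))

  route-through-edge : ∀ {f es k} → RoutedBy (pathsEs f es) k →
    Σ (Bool × Node) λ e → e ∈ es × sat cs (row k) (f , proj₁ e) × RoutedBy (pathsN (proj₂ e)) k
  route-through-edge {f} {es} (τ , τ∈ , sats , dec) with ∈-pathsEs⁻ {f} {es} τ∈
  ... | e , e∈ , q , q∈ , refl with sats
  ...   | s ∷ ss = e , e∈ , s , q , q∈ , ss , dec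

  -- Rows whose tag differs from f agree on f, so determinism sends them all down one edge.
  common-edge : ∀ {f} es → Unique (map proj₁ es) → ∀ {e₀} → e₀ ∈ es → ∀ G →
    All (λ k → tag k ≢ f) G → All (RoutedBy (pathsEs f es)) G →
    Σ (Bool × Node) λ e → e ∈ es × All (RoutedBy (pathsN (proj₂ e))) G
  common-edge es _ e₀∈ [] _ _ = _ , e₀∈ , []
  common-edge {f} es u _ (k₀ ∷ G) tags@(k₀≢f ∷ _) routes@(route₀ ∷ _)
    with route-through-edge {f} {es} route₀
  ... | e , e∈ , s , _ = e , e∈ , All.zipWith (λ (tk , r) → reroute tk r) (tags , routes)
    where
    reroute : ∀ {k} → tag k ≢ f → RoutedBy (pathsEs f es) k → RoutedBy (pathsN (proj₂ e)) k
    reroute {k} tk r with route-through-edge {f} {es} r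
    ... | e′ , e′∈ , s′ , r′ =
      subst (λ x → RoutedBy (pathsN (proj₂ x)) k)
        (unique-map-injective u e′∈ e∈ (agree k k₀ (tk ∘ sym) (k₀≢f ∘ sym) s′ s)) r′

  HasLongPath : Node → Set
  HasLongPath N = DetN N → ∀ F → Unique (map tag F) → All (RoutedBy (pathsN N)) F →
    Σ (Word × ℕ) λ τ → τ ∈ pathsN N × length F ≤ suc (length (proj₁ τ))

  mutual
    long-path : ∀ N → HasLongPath N
    long-path (leaf d) _ F uF routes = ([] , d) , here refl , length≤1
      where
      tagged-d : All (λ k → ¬ tag k ≢ d) F
      tagged-d = All.map (λ { (_ , here refl , _ , d≡tag) tag≢d → tag≢d (sym d≡tag) }) routes
      length≤1 : length F ≤ 1
      length≤1 = subst (λ G → length F ≤ suc (length G)) (LP.filter-none (tag≢? d) tagged-d)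
                   (at-most-one-tagged d F uF)
    long-path (node f (δ , n) es) (labels-unique , dets) F uF routes
      with common-edge ((δ , n) ∷ es) labels-unique (here refl) (filter (tag≢? f) F)
             (AllP.all-filter (tag≢? f) F) (AllP.filter⁺ (tag≢? f) routes)
    ... | e , e∈ , routes′
      with All.lookup (long-path n ∷ long-paths es) e∈ (All.lookup (DetEs⇒All _ dets) e∈)
             (filter (tag≢? f) F) (filter-tags-unique f uF) routes′
    ... | q , q∈ , q-long =
      extendPath f (proj₁ e) q , ∈-pathsEs⁺ e∈ q∈ ,
      NP.≤-trans (at-most-one-tagged f F uF) (s≤s q-long)

    long-paths : ∀ es → All (λ e → HasLongPath (proj₂ e)) es
    long-paths [] = []
    long-paths ((_ , n) ∷ es) = long-path n ∷ long-paths es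

module Refutation (T : Table) (x₀ : Letter) (xs : Word) (irr : IrrAnn T (x₀ ∷ xs)) where

  α : Word
  α = x₀ ∷ xs

  inΩ : InΩ T α
  inΩ = proj₁ (proj₁ irr)

  annihilates : IsΛ (sub T α)
  annihilates = proj₁ (proj₂ (proj₁ irr))

  cs : List ℕ
  cs = cols T

  attrs : List ℕ
  attrs = map proj₁ α

  D : List ℕ
  D = filter (λ c → ¬? (c ∈? attrs)) cs

  cs* : List ℕ
  cs* = filter (λ c → ¬? (c ∈? D)) cs

  failed : List Bool → Word
  failed bs = filter (λ l → ¬? (sat? cs* bs l)) α

  ν : List Bool → DecSet
  ν bs = toDecSet (map proj₁ (failed bs))

  T* : Table
  T* = J ν (I D T)

  D⊆cs : All (_∈ cs) D
  D⊆cs = All.tabulate (λ f∈ → proj₁ (∈-filter⁻ (λ c → ¬? (c ∈? attrs)) f∈))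

  attr∉D : ∀ {f} → f ∈ attrs → f ∉ D
  attr∉D f∈ f∈D = proj₂ (∈-filter⁻ (λ c → ¬? (c ∈? attrs)) {xs = cs} f∈D) f∈

  attr∈cs : ∀ {f} → f ∈ attrs → f ∈ cs
  attr∈cs f∈ with ∈-map⁻ proj₁ f∈
  ... | _ , l∈ , refl = All.lookup inΩ l∈

  attr∈cs* : ∀ {f} → f ∈ attrs → f ∈ cs*
  attr∈cs* f∈ = ∈-filter⁺ (λ c → ¬? (c ∈? D)) (attr∈cs f∈) (attr∉D f∈)

  cs*⊆attrs : ∀ {f} → f ∈ cs* → f ∈ attrs
  cs*⊆attrs {f} f∈ with ∈-filter⁻ (λ c → ¬? (c ∈? D)) {xs = cs} f∈ | f ∈? attrs
  ... | _ | yes f∈attrs = f∈attrs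
  ... | f∈cs , f∉D | no f∉attrs = ⊥-elim (f∉D (∈-filter⁺ (λ c → ¬? (c ∈? attrs)) f∈cs f∉attrs))

  val-restrict-attr : ∀ bs {f} → f ∈ attrs → val cs* (restrict D cs bs) f ≡ val cs bs f
  val-restrict-attr bs f∈ = val-restrict D cs bs (attr∉D f∈)

  private
    alive-row : ∀ {x} (p : x ∈ α) → Σ Row (_∈ rows (sub T (α ─ p)))
    alive-row p = ¬IsΛ⇒∈ (sub T (α ─ p)) λ empty →
      proj₂ irr (α ─ p) (─-⊆ p) (─-≢ p) (annihilating-⊆ {T} (─-⊆ p) (proj₁ irr) empty)

  witness : ∀ {x} → x ∈ α → Row
  witness p = proj₁ (alive-row p)

  witness∈T : ∀ {x} (p : x ∈ α) → witness p ∈ rows T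
  witness∈T p = proj₁ (∈-sub⁻ T (α ─ p) (proj₂ (alive-row p)))

  witness-sat-others : ∀ {x} (p : x ∈ α) → All (sat cs (proj₁ (witness p))) (α ─ p)
  witness-sat-others p = proj₂ (∈-sub⁻ T (α ─ p) (proj₂ (alive-row p)))

  witness-¬sat : ∀ {x} (p : x ∈ α) → ¬ sat cs (proj₁ (witness p)) x
  witness-¬sat p s = IsΛ-sub⇒¬All T α annihilates (witness∈T p)
    (AllP.─⁻ p (subst (sat cs (proj₁ (witness p))) (AnyP.lookup-result p) s) (witness-sat-others p))

  attrs-unique : Unique attrs
  attrs-unique = unique-attributes α (proj₂ (proj₂ (proj₁ irr)))
    (∉-─⇒unique λ p x∈ → witness-¬sat p (All.lookup (witness-sat-others p) x∈))

  witness* : ∀ {x} → x ∈ α → List Bool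
  witness* p = restrict D cs (proj₁ (witness p))

  witness*-sat : ∀ {x y} (p : x ∈ α) → y ∈ α → proj₁ y ≢ proj₁ x → sat cs* (witness* p) y
  witness*-sat {y = f , δ} p y∈ f≢ = trans (val-restrict-attr _ (∈-map⁺ proj₁ y∈))
    (All.lookup (witness-sat-others p) (∈-─⁺ y∈ (f≢ ∘ cong proj₁) p))

  witness*-failed : ∀ {x} (p : x ∈ α) → x ∈ failed (witness* p)
  witness*-failed {f , δ} p = ∈-filter⁺ (λ l → ¬? (sat? cs* (witness* p) l)) p
    (witness-¬sat p ∘ trans (sym (val-restrict-attr _ (∈-map⁺ proj₁ p))))

  witness*∈T* : ∀ {x} (p : x ∈ α) → (witness* p , ν (witness* p)) ∈ rows T*
  witness*∈T* p = ∈-JI⁺ D ν T (witness∈T p)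

  witness*-decision : ∀ {x d} (p : x ∈ α) → d ∈ toList (ν (witness* p)) → d ≡ proj₁ x
  witness*-decision {x} p d∈
    with ∈-map⁻ proj₁ (∈-toDecSet⁻ (∈-map⁺ proj₁ (witness*-failed p)) d∈)
  ... | l , l∈failed , refl with ∈-filter⁻ (λ l → ¬? (sat? cs* (witness* p) l)) {xs = α} l∈failed
  ...   | l∈α , ¬sat-l with proj₁ l N.≟ proj₁ x
  ...     | yes eq = eq
  ...     | no ne = ⊥-elim (¬sat-l (witness*-sat p l∈α ne))

  Occurrence : Set
  Occurrence = Σ Letter (_∈ α)

  -- Off their own attributes, witness rows satisfy the letters of α, which fix the values.
  occurrences-agree : ∀ (k k′ : Occurrence) {f δ δ′} → f ≢ proj₁ (proj₁ k) → f ≢ proj₁ (proj₁ k′) →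
    sat cs* (witness* (proj₂ k)) (f , δ) → sat cs* (witness* (proj₂ k′)) (f , δ′) → δ ≡ δ′
  occurrences-agree (_ , p) (_ , p′) f≢ f≢′ s s′
    with ∈-map⁻ proj₁ (cs*⊆attrs (val-just⇒∈ cs* _ s))
  ... | (_ , σ) , l∈ , refl =
    trans (MP.just-injective (trans (sym s) (witness*-sat p l∈ f≢)))
          (sym (MP.just-injective (trans (sym s′) (witness*-sat p′ l∈ f≢′))))

  refutingTree : Tree
  refutingTree = tree (refuteNode x₀) (map refuteNode xs)

  ∈-paths-refutingTree⁻ : ∀ {τ} → τ ∈ paths refutingTree →
    Σ Letter λ x → x ∈ α × τ ≡ refutation x
  ∈-paths-refutingTree⁻ {τ} τ∈ = ∈-map⁻ refutation (subst (τ ∈_) (pathsNs-refuteNode α) τ∈)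

  ∈-paths-refutingTree⁺ : ∀ {x} → x ∈ α → refutation x ∈ paths refutingTree
  ∈-paths-refutingTree⁺ {x} x∈ =
    subst (refutation x ∈_) (sym (pathsNs-refuteNode α)) (∈-map⁺ refutation x∈)

  refutingTree-for-T* : InM T → NDTreeFor T* refutingTree
  refutingTree-for-T* (_ , complete , _) = attributes , covered , correct
    where
    attributes : All (_∈ cs*) (At refutingTree)
    attributes = subst (All (_∈ cs*)) (sym (attNs-refuteNode α)) (All.tabulate attr∈cs*)

    covered : ∀ r → r ∈ rows T* →
      Σ (Word × ℕ) λ τ → τ ∈ paths refutingTree × r ∈ rows (sub T* (proj₁ τ))
    covered r r∈ with ∈-JI⁻ D ν T r∈
    ... | r₀ , r₀∈ , refl with find (AllP.¬All⇒Any¬ (sat? cs (proj₁ r₀)) α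
                                    (IsΛ-sub⇒¬All T α annihilates r₀∈))
    ...   | (f , δ) , x∈ , ¬s =
      refutation (f , δ) , ∈-paths-refutingTree⁺ x∈ ,
      ∈-sub⁺ T* _ r∈ (trans (val-restrict-attr (proj₁ r₀) f∈)
                        (¬sat⇒sat-not (attr∈cs f∈) (All.lookup complete r₀∈) ¬s) ∷ [])
      where f∈ = ∈-map⁺ proj₁ x∈

    correct : ∀ τ → τ ∈ paths refutingTree →
      IsΛ (sub T* (proj₁ τ)) ⊎ InΠ (proj₂ τ) (sub T* (proj₁ τ))
    correct τ τ∈ with ∈-paths-refutingTree⁻ τ∈
    ... | (f , δ) , x∈ , refl = inj₂ (All.tabulate refuted)
      where
      refuted : ∀ {r} → r ∈ rows (sub T* ((f , not δ) ∷ [])) → f ∈ toList (proj₂ r)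
      refuted {r} r∈ with ∈-sub⁻ T* _ r∈
      ... | r∈T* , s ∷ [] = subst (λ ds → f ∈ toList ds) (sym (decision-J ν (I D T) r∈T*))
        (∈-toDecSet⁺ (∈-map⁺ proj₁ (∈-filter⁺ (λ l → ¬? (sat? cs* (proj₁ r) l)) x∈
          (sat-not⇒¬sat {cs*} {proj₁ r} {f} {δ} s))))

  ψ-refutingTree : ∀ ψ {n} → mψ≤ ψ T n → ψt ψ refutingTree ≤ n
  ψ-refutingTree ψ {n} mψ = ψt≤ ψ refutingTree λ τ∈ → bound (∈-paths-refutingTree⁻ τ∈)
    where
    bound : ∀ {τ} → Σ Letter (λ x → x ∈ α × τ ≡ refutation x) → ψw ψ (proj₁ τ) ≤ n
    bound ((f , δ) , x∈ , refl) = All.lookup mψ (attr∈cs (∈-map⁺ proj₁ x∈))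

  T*-nonempty : ¬ IsΛ T*
  T*-nonempty = ∈⇒¬IsΛ T* (witness*∈T* (here refl))

  occurrences : List Occurrence
  occurrences = mapWith∈ α (λ {x} p → x , p)

  open LongPath cs* (proj₁ ∘ proj₁) (witness* ∘ proj₂) occurrences-agree

  tags-occurrences : map (proj₁ ∘ proj₁) occurrences ≡ attrs
  tags-occurrences =
    trans (map-mapWith∈ α (λ {x} p → x , p) (proj₁ ∘ proj₁)) (mapWith∈≗map proj₁ α)

  length-occurrences : length occurrences ≡ length α
  length-occurrences = length-mapWith∈ (≡.setoid Letter) α {λ {x} p → x , p}

  occurrence-routed : ∀ {first} → NDTreeFor T* (tree first []) → ∀ k → RoutedBy (pathsN first) k
  occurrence-routed {first} (_ , covered , correct) (x , p) with covered _ (witness*∈T* p)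
  ... | τ , τ∈ , row∈ = τ , subst (τ ∈_) (LP.++-identityʳ (pathsN first)) τ∈ ,
                        proj₂ (∈-sub⁻ T* (proj₁ τ) row∈) , decision (correct τ τ∈)
    where
    decision : IsΛ (sub T* (proj₁ τ)) ⊎ InΠ (proj₂ τ) (sub T* (proj₁ τ)) → proj₂ τ ≡ proj₁ x
    decision (inj₁ empty) = ⊥-elim (∈⇒¬IsΛ (sub T* (proj₁ τ)) row∈ empty)
    decision (inj₂ inΠ) = witness*-decision p (All.lookup inΠ row∈)

  ψᵈ-T*≥ : ∀ ψ → IsBoundedComplexityMeasure ψ → ∀ Γ → DTreeFor T* Γ → length α ∸ 1 ≤ ψt ψ Γ
  ψᵈ-T*≥ ψ (_ , length≤ψ) (tree first others) (forT* , refl , det)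
    with long-path first det occurrences (subst Unique (sym tags-occurrences) attrs-unique)
           (All.tabulate λ {k} _ → occurrence-routed forT* k)
  ... | q , q∈ , long = begin
    length α ∸ 1                  ≡⟨ cong (_∸ 1) (sym length-occurrences) ⟩
    length occurrences ∸ 1        ≤⟨ NP.m≤n+o⇒m∸n≤o (length occurrences) 1 long ⟩
    length (proj₁ q)              ≡⟨ sym (LP.length-map proj₁ (proj₁ q)) ⟩
    length (map proj₁ (proj₁ q))  ≤⟨ length≤ψ (map proj₁ (proj₁ q)) ⟩
    ψw ψ (proj₁ q)                ≤⟨ ψw≤ψt ψ (tree first []) (∈-++⁺ˡ q∈) ⟩
    ψt ψ (tree first [])          ∎
    where open NP.≤-Reasoning

lemma13 : (A : Class) → ClassOfM A → Closed A → Nontrivial A →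
    (ψ : List ℕ → ℕ) → IsBoundedComplexityMeasure ψ →
    (n : ℕ) (T : Table) → A T → mψ≤ ψ T n →
    (g : ℕ) → IsG T g → 0 < g →
    Σ Table λ T* → T* ∈[ T ] × ψᵃ≤ ψ T* n × ψᵈ≥ ψ T* (g ∸ 1)
lemma13 _ _ _ _ _ _ _ _ _ _ _ (_ , inj₂ (_ , refl)) ()
lemma13 _ _ _ _ _ _ _ _ _ _ .0 (_ , inj₁ ([] , _ , refl)) ()
lemma13 _ inM _ _ ψ bounded n T T∈A mψ _ (_ , inj₁ (x₀ ∷ xs , irr , refl)) _ =
  T* , (D , ν , D⊆cs , refl) ,
  inj₂ (refutingTree , refutingTree-for-T* (inM T T∈A) , ψ-refutingTree ψ mψ) ,
  (⊥-elim ∘ T*-nonempty) , (λ _ → ψᵈ-T*≥ ψ bounded)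
  where open Refutation T x₀ xs irr
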